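{- Let $X=(\Omega,\mathcal{B})$ be a connected balanced configuration, let $C\le\operatorname{Aut}X$ be a cyclic subgroup acting regularly on $\Omega$, and let $G$ be a $\prec$-minimal group with $C\le G\le\operatorname{Aut}X$. Then for any point $\alpha\in\Omega$ and line $\beta\in\mathcal{B}$ with $\alpha\in\beta$, and for any nontrivial subgroup $F\le C$, we have $\beta^F\not\subseteq\beta^{G_\alpha}$ and $\alpha^F\not\subseteq\alpha^{G_\beta}$.
   Context: An incidence geometry $(\Omega,\mathcal{B})$ consists of a finite set $\Omega$ of points and a collection $\mathcal{B}\subseteq 2^\Omega$ of lines with $|B\cap B'|\le 1$ for distinct lines. It is a configuration if every point lies on exactly $r$ lines and every line has exactly $k\ge3$ points; balanced if $|\Omega|=|\mathcal{B}|$. $\operatorname{Aut}X$ is the group of permutations $g$ of $\Omega$ with $\mathcal{B}^g=\mathcal{B}$, acting also on $\mathcal{B}$; $G_\alpha$, $G_\beta$ denote stabilizers in $G$, and $x^H$ denotes the $H$-orbit of $x$. $X$ is connected if its incidence graph (bipartite graph on $\Omega\cup\mathcal{B}$ with $\omega\sim B$ iff $\omega\in B$) is connected. A c-group is a subgroup of $\mathrm{Sym}(\Omega)$ containing a regular cyclic subgroup. For c-groups $A,B$, $A\prec B$ means $A\le B$ and every regular cyclic subgroup $L\le B$ has a $B$-conjugate contained in $A$. $G$ is $\prec$-minimal if there is no c-group $H\ne G$ with $H\prec G$. -}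

module Defs where

open import Data.Nat using (ℕ; zero; suc; _≤_; _≡ᵇ_)
open import Data.Fin using (Fin)
open import Data.Fin.Permutation using (Permutation′; _⟨$⟩ʳ_; _⟨$⟩ˡ_; id; flip; _∘ₚ_; _≈_)
open import Data.Fin.Subset using (Subset; _∈_; _∩_; ∣_∣)
open import Data.Vec using (tabulate; lookup)
open import Data.Sum using (_⊎_; inj₁; inj₂)
open import Data.Product using (Σ; ∃; _×_; _,_)
open import Data.Empty using (⊥)
open import Relation.Nullary using (¬_)
open import Relation.Binary.PropositionalEquality using (_≡_; _≢_)
open import Relation.Binary.Construct.Closure.ReflexiveTransitive using (Star)
open import Function.Bundles using (_⇔_)

Perm : ℕ → Set
Perm = Permutation′

record Subgroup (n : ℕ) : Set₁ where
  field
    mem   : Perm n → Set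
    resp  : ∀ {g h} → g ≈ h → mem g → mem h
    hasId : mem id
    comp  : ∀ {g h} → mem g → mem h → mem (g ∘ₚ h)
    inv   : ∀ {g} → mem g → mem (flip g)
open Subgroup public

_⊆G_ : ∀ {n} → Subgroup n → Subgroup n → Set
H ⊆G G = ∀ g → mem H g → mem G g

pow : ∀ {n} → Perm n → ℕ → Perm n
pow c zero    = id
pow c (suc k) = c ∘ₚ pow c k

IsCyclic : ∀ {n} → Subgroup n → Set
IsCyclic {n} C = Σ (Perm n) λ c → ∀ g → mem C g ⇔ (∃ λ k → g ≈ pow c k)

IsRegular : ∀ {n} → Subgroup n → Set
IsRegular {n} H =
  ((α β : Fin n) → Σ (Perm n) λ g → mem H g × g ⟨$⟩ʳ α ≡ β) ×
  ((α : Fin n) (g : Perm n) → mem H g → g ⟨$⟩ʳ α ≡ α → g ≈ id)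

IsRegularCyclic : ∀ {n} → Subgroup n → Set
IsRegularCyclic H = IsCyclic H × IsRegular H

IsCGroup : ∀ {n} → Subgroup n → Set₁
IsCGroup {n} G = Σ (Subgroup n) λ L → IsRegularCyclic L × L ⊆G G

ConjIn : ∀ {n} → Subgroup n → Perm n → Subgroup n → Set
ConjIn L b A = ∀ l → mem L l → mem A (flip b ∘ₚ (l ∘ₚ b))

_≺_ : ∀ {n} → Subgroup n → Subgroup n → Set₁
_≺_ {n} A B = A ⊆G B ×
  ((L : Subgroup n) → IsRegularCyclic L → L ⊆G B →
     Σ (Perm n) λ b → mem B b × ConjIn L b A)

SameGroup : ∀ {n} → Subgroup n → Subgroup n → Set
SameGroup H G = H ⊆G G × G ⊆G H

IsPrecMinimal : ∀ {n} → Subgroup n → Set₁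
IsPrecMinimal {n} G = IsCGroup G ×
  ((H : Subgroup n) → IsCGroup H → H ≺ G → ¬ ¬ SameGroup H G)

img : ∀ {n} → Perm n → Subset n → Subset n
img g S = tabulate λ i → lookup S (g ⟨$⟩ˡ i)

record Geometry (n m : ℕ) : Set where
  field
    line      : Fin m → Subset n
    line-inj  : ∀ i j → line i ≡ line j → i ≡ j
    meet≤1    : ∀ i j → i ≢ j → ∣ line i ∩ line j ∣ ≤ 1
open Geometry public

linesThrough : ∀ {n m} → Geometry n m → Fin n → ℕ
linesThrough X ω = ∣ tabulate (λ j → lookup (line X j) ω) ∣

IsConfiguration : ∀ {n m} → Geometry n m → Set
IsConfiguration {n} {m} X = Σ ℕ λ r → Σ ℕ λ k → 3 ≤ k ×
  ((ω : Fin n) → linesThrough X ω ≡ r) × ((j : Fin m) → ∣ line X j ∣ ≡ k)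

IsBalanced : ∀ {n m} → Geometry n m → Set
IsBalanced {n} {m} _ = n ≡ m

Incident : ∀ {n m} → Geometry n m → Fin n ⊎ Fin m → Fin n ⊎ Fin m → Set
Incident X (inj₁ p) (inj₂ l) = p ∈ line X l
Incident X (inj₂ l) (inj₁ p) = p ∈ line X l
Incident X (inj₁ _) (inj₁ _) = ⊥
Incident X (inj₂ _) (inj₂ _) = ⊥

IsConnected : ∀ {n m} → Geometry n m → Set
IsConnected X = ∀ x y → Star (Incident X) x y

IsAut : ∀ {n m} → Geometry n m → Perm n → Set
IsAut {n} {m} X g =
  ((j : Fin m) → Σ (Fin m) λ j′ → img g (line X j) ≡ line X j′) ×
  ((j′ : Fin m) → Σ (Fin m) λ j → img g (line X j) ≡ line X j′)

InAut : ∀ {n m} → Geometry n m → Subgroup n → Set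
InAut X G = ∀ g → mem G g → IsAut X g

PtStab : ∀ {n} → Subgroup n → Fin n → Perm n → Set
PtStab G α g = mem G g × g ⟨$⟩ʳ α ≡ α

LineStab : ∀ {n} → Subgroup n → Subset n → Perm n → Set
LineStab G B g = mem G g × img g B ≡ B

InPtOrbit : ∀ {n} → (Perm n → Set) → Fin n → Fin n → Set
InPtOrbit {n} H x₀ x = Σ (Perm n) λ h → H h × h ⟨$⟩ʳ x₀ ≡ x

InLineOrbit : ∀ {n} → (Perm n → Set) → Subset n → Subset n → Set
InLineOrbit {n} H B₀ B = Σ (Perm n) λ h → H h × img h B₀ ≡ B

PtOrbitSub : ∀ {n} → (Perm n → Set) → (Perm n → Set) → Fin n → Set
PtOrbitSub H K x₀ = ∀ x → InPtOrbit H x₀ x → InPtOrbit K x₀ x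

LineOrbitSub : ∀ {n} → (Perm n → Set) → (Perm n → Set) → Subset n → Set
LineOrbitSub H K B₀ = ∀ B → InLineOrbit H B₀ B → InLineOrbit K B₀ B

Nontrivial : ∀ {n} → Subgroup n → Set
Nontrivial {n} F = Σ (Perm n) λ f → mem F f × ¬ (f ≈ id)

-- If f ∈ F is nontrivial, either inclusion puts both f⁻¹ α and f α on β; then β and f(β) share the
-- distinct points α and f α, so f fixes β. That is impossible. If c^s, with s minimal, stabilises a line
-- through α, the line is exactly the ⟨c^s⟩-orbit of α and so has N / s points (N the order of c).
-- All lines have k points, so s is determined by k and there is at most one such line through α.
-- Pigeonholing the N translates of a line through α (together with β) shows that every line is a
-- translate of β; but β has only s < N translates while a balanced configuration has N lines.
module Submission where

open import Defs
open import Data.Nat using (ℕ)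
open import Data.Fin using (Fin)
open import Data.Fin.Subset using (_∈_)
open import Data.Product using (_×_)
open import Relation.Nullary using (¬_)

open import Data.Bool.Properties using () renaming (_≟_ to _≟ᵇ_)
open import Data.Empty using (⊥; ⊥-elim)
open import Data.Fin as Fin using (toℕ)
open import Data.Fin.Permutation using (_⟨$⟩ʳ_; _⟨$⟩ˡ_; id; flip; _∘ₚ_; _≈_; inverseˡ; inverseʳ)
import Data.Fin.Properties as Finₚ
open import Data.Fin.Subset as Subset using (Subset; ∣_∣; _∉_; _∪_; ⁅_⁆; _⊆_; inside; outside)
open import Data.Fin.Subset.Properties

open import Data.Nat using (zero; suc; s≤s⁻¹; >-nonZero; _+_; _*_; _∸_; _≤_; _<_; z≤n; s≤s; _/_; _%_; NonZero)
open import Data.Nat.Properties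
open import Data.Nat.DivMod using (m≡m%n+[m/n]*n; m%n<n)
open import Data.Nat.Divisibility using (_∣_; divides; ∣⇒≤)
open import Data.Product using (∃; _,_; proj₁; proj₂)
open import Data.Sum using (inj₁; inj₂)
open import Data.Vec using ([]; _∷_; lookup; tabulate; here; there)
open import Data.Vec.Properties using (≡-dec; lookup∘tabulate; tabulate-cong; tabulate∘lookup; []=⇒lookup; lookup⇒[]=)
open import Function.Base using (_∘′_)
open import Function.Definitions using (Injective)
open import Function.Bundles using (Equivalence)
open import Relation.Binary.PropositionalEquality
open import Relation.Nullary using (yes; no)
open import Relation.Unary using (Decidable)
open import Relation.Binary.Definitions using (tri<; tri≈; tri>)

private
  variable
    n m : ℕ
    g h : Perm n
    S : Subset n
    x y : Fin n

⟨$⟩ʳ-injective : (g : Perm n) → g ⟨$⟩ʳ x ≡ g ⟨$⟩ʳ y → x ≡ y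
⟨$⟩ʳ-injective g eq = trans (sym (inverseˡ g)) (trans (cong (g ⟨$⟩ˡ_) eq) (inverseˡ g))

≈⇒≈ˡ : g ≈ h → ∀ x → g ⟨$⟩ˡ x ≡ h ⟨$⟩ˡ x
≈⇒≈ˡ {g = g} {h = h} g≈h x =
  ⟨$⟩ʳ-injective g (trans (inverseʳ g) (trans (sym (inverseʳ h)) (sym (g≈h (h ⟨$⟩ˡ x)))))

pow-+ : (c : Perm n) (a b : ℕ) → pow c (a + b) ≈ pow c a ∘ₚ pow c b
pow-+ c zero    b x = refl
pow-+ c (suc a) b x = pow-+ c a b (c ⟨$⟩ʳ x)

lookup-img : (g : Perm n) (S : Subset n) (x : Fin n) → lookup (img g S) x ≡ lookup S (g ⟨$⟩ˡ x)
lookup-img g S = lookup∘tabulate _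

∈-img : (g : Perm n) → x ∈ S → g ⟨$⟩ʳ x ∈ img g S
∈-img {x = x} {S = S} g x∈S =
  lookup⇒[]= _ _ (trans (lookup-img g S _) (trans (cong (lookup S) (inverseˡ g)) ([]=⇒lookup x∈S)))

∈-img⁻ : x ∈ img g S → g ⟨$⟩ˡ x ∈ S
∈-img⁻ {x = x} {g = g} {S = S} x∈gS = lookup⇒[]= _ _ (trans (sym (lookup-img g S x)) ([]=⇒lookup x∈gS))

img-cong : (g h : Perm n) → g ≈ h → (S : Subset n) → img g S ≡ img h S
img-cong g h g≈h S = tabulate-cong λ x → cong (lookup S) (≈⇒≈ˡ {g = g} {h = h} g≈h x)

img-∘ₚ : (g h : Perm n) (S : Subset n) → img (g ∘ₚ h) S ≡ img h (img g S)
img-∘ₚ g h S = tabulate-cong λ x → sym (lookup-img g S (h ⟨$⟩ˡ x))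

img-id : (S : Subset n) → img id S ≡ S
img-id = tabulate∘lookup

distinct∈p⇒1<∣p∣ : x ≢ y → x ∈ S → y ∈ S → 1 < ∣ S ∣
distinct∈p⇒1<∣p∣ {x = x} {y = y} x≢y x∈S y∈S = subst (_< _) (∣⁅x⁆∣≡1 x) (p⊂q⇒∣p∣<∣q∣ (⁅x⁆⊆S , y , y∈S , y∉⁅x⁆))
  where
  ⁅x⁆⊆S : ⁅ x ⁆ ⊆ _
  ⁅x⁆⊆S z∈⁅x⁆ = subst (_∈ _) (sym (x∈⁅y⁆⇒x≡y x z∈⁅x⁆)) x∈S
  y∉⁅x⁆ : y ∉ ⁅ x ⁆
  y∉⁅x⁆ y∈⁅x⁆ = x≢y (sym (x∈⁅y⁆⇒x≡y x y∈⁅x⁆))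

∣⁅x⁆∪p∣≡1+∣p∣ : x ∉ S → ∣ ⁅ x ⁆ ∪ S ∣ ≡ suc ∣ S ∣
∣⁅x⁆∪p∣≡1+∣p∣ {x = Fin.zero}  {S = inside  ∷ S} x∉S = ⊥-elim (x∉S here)
∣⁅x⁆∪p∣≡1+∣p∣ {x = Fin.zero}  {S = outside ∷ S} x∉S = cong (suc ∘′ ∣_∣) (∪-identityˡ S)
∣⁅x⁆∪p∣≡1+∣p∣ {x = Fin.suc x} {S = inside  ∷ S} x∉S = cong suc (∣⁅x⁆∪p∣≡1+∣p∣ (x∉S ∘′ there))
∣⁅x⁆∪p∣≡1+∣p∣ {x = Fin.suc x} {S = outside ∷ S} x∉S = ∣⁅x⁆∪p∣≡1+∣p∣ (x∉S ∘′ there)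

imageUpTo : (ℕ → Fin n) → ℕ → Subset n
imageUpTo e zero    = Subset.⊥
imageUpTo e (suc o) = ⁅ e o ⁆ ∪ imageUpTo e o

module _ (e : ℕ → Fin n) where

  ∈-imageUpTo : ∀ {q o} → q < o → e q ∈ imageUpTo e o
  ∈-imageUpTo {q} {suc o} q<1+o with m≤n⇒m<n∨m≡n (s≤s⁻¹ q<1+o)
  ... | inj₁ q<o  = q⊆p∪q ⁅ e o ⁆ _ (∈-imageUpTo q<o)
  ... | inj₂ refl = p⊆p∪q _ (x∈⁅x⁆ (e q))

  ∈-imageUpTo⁻ : ∀ o → x ∈ imageUpTo e o → ∃ λ q → q < o × e q ≡ x
  ∈-imageUpTo⁻ zero    x∈⊥ = ⊥-elim (∉⊥ x∈⊥)
  ∈-imageUpTo⁻ (suc o) x∈e with x∈p∪q⁻ ⁅ e o ⁆ (imageUpTo e o) x∈e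
  ... | inj₁ x∈⁅eo⁆ = o , ≤-refl , sym (x∈⁅y⁆⇒x≡y (e o) x∈⁅eo⁆)
  ... | inj₂ x∈e′ with q , q<o , eq ← ∈-imageUpTo⁻ o x∈e′ = q , m≤n⇒m≤1+n q<o , eq

  ∣imageUpTo∣ : ∀ o → (∀ {q r} → q < o → r < o → e q ≡ e r → q ≡ r) → ∣ imageUpTo e o ∣ ≡ o
  ∣imageUpTo∣ zero    _   = ∣⊥∣≡0 n
  ∣imageUpTo∣ (suc o) inj =
    trans (∣⁅x⁆∪p∣≡1+∣p∣ eo∉) (cong suc (∣imageUpTo∣ o λ q<o r<o → inj (m≤n⇒m≤1+n q<o) (m≤n⇒m≤1+n r<o)))
    where
    eo∉ : e o ∉ imageUpTo e o
    eo∉ eo∈ with q , q<o , eq ← ∈-imageUpTo⁻ o eo∈ = <-irrefl (inj (m≤n⇒m≤1+n q<o) ≤-refl eq) q<o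

record Period (P : ℕ → Set) : Set where
  field
    period      : ℕ
    {{nonZero}} : NonZero period
    holds       : P period
    minimal     : ∀ {u} → 0 < u → u < period → ¬ P u

period-search : {P : ℕ → Set} → Decidable P → ∀ {t} → 0 < t → P t → Period P
period-search {P} P? {suc t} _ Pt = from 1 t (λ 0<u u<1 _ → <⇒≱ 0<u (s≤s⁻¹ u<1)) Pt
  where
  from : ∀ k d → ⦃ NonZero k ⦄ → (∀ {u} → 0 < u → u < k → ¬ P u) → P (k + d) → Period P
  from k zero below Pk = record { period = k ; holds = subst P (+-identityʳ k) Pk ; minimal = below }
  from k (suc d) below Pk+d with P? k
  ... | yes Pk = record { period = k ; holds = Pk ; minimal = below }
  ... | no ¬Pk = from (suc k) d below′ (subst P (+-suc k d) Pk+d)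
    where
    below′ : ∀ {u} → 0 < u → u < suc k → ¬ P u
    below′ 0<u u<1+k with m≤n⇒m<n∨m≡n (s≤s⁻¹ u<1+k)
    ... | inj₁ u<k  = below 0<u u<k
    ... | inj₂ refl = ¬Pk

multiples : {P : ℕ → Set} → P 0 → (∀ a b → P a → P b → P (a + b)) → ∀ {s} → P s → ∀ q → P (q * s)
multiples     P-0 P-+     Ps zero    = P-0
multiples {P} P-0 P-+ {s} Ps (suc q) = P-+ s (q * s) Ps (multiples {P} P-0 P-+ Ps q)

module _ {P : ℕ → Set} (P-0 : P 0) (P-+ : ∀ a b → P a → P b → P (a + b))
         (P-∸ : ∀ a b → P (a + b) → P a → P b) where

  period-∣ : (p : Period P) → ∀ {t} → P t → Period.period p ∣ t
  period-∣ p {t} Pt = remainder-zero (t % s) refl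
    where
    open Period p renaming (period to s)
    P[t%s] : P (t % s)
    P[t%s] = P-∸ (t / s * s) (t % s) (subst P (trans (m≡m%n+[m/n]*n t s) (+-comm (t % s) _)) Pt)
                 (multiples {P} P-0 P-+ holds (t / s))
    remainder-zero : ∀ r → t % s ≡ r → s ∣ t
    remainder-zero zero    t%s≡0   = divides (t / s) (trans (m≡m%n+[m/n]*n t s) (cong (_+ t / s * s) t%s≡0))
    remainder-zero (suc r) t%s≡1+r =
      ⊥-elim (minimal (s≤s z≤n) (subst (_< s) t%s≡1+r (m%n<n t s)) (subst P t%s≡1+r P[t%s]))

x∈p⇒0<∣p∣ : x ∈ S → 0 < ∣ S ∣
x∈p⇒0<∣p∣ x∈S = ≤-<-trans z≤n (x∈p⇒∣p-x∣<∣p∣ x∈S)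

lines-through-two-points : (X : Geometry n m) {i j : Fin m} → x ≢ y →
  x ∈ line X i → y ∈ line X i → x ∈ line X j → y ∈ line X j → i ≡ j
lines-through-two-points X {i} {j} x≢y x∈i y∈i x∈j y∈j with i Fin.≟ j
... | yes i≡j = i≡j
... | no  i≢j =
  ⊥-elim (<⇒≱ (distinct∈p⇒1<∣p∣ x≢y (x∈p∩q⁺ (x∈i , x∈j)) (x∈p∩q⁺ (y∈i , y∈j))) (meet≤1 X i j i≢j))

module RegularCyclicAction {n m : ℕ} (X : Geometry n m) (c : Perm n) (α : Fin n)
  (semiregular : ∀ t {x} → pow c t ⟨$⟩ʳ x ≡ x → pow c t ≈ id)
  (transitive : ∀ x → ∃ λ t → pow c t ⟨$⟩ʳ α ≡ x)
  (translate : ∀ t j → ∃ λ j′ → img (pow c t) (line X j) ≡ line X j′)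
  where

  infixr 5 _·_ _·ₛ_

  _·_ : ℕ → Fin n → Fin n
  t · x = pow c t ⟨$⟩ʳ x

  _·ₛ_ : ℕ → Subset n → Subset n
  t ·ₛ S = img (pow c t) S

  ·-+ : ∀ a b x → (a + b) · x ≡ a · b · x
  ·-+ a b x = trans (cong (_· x) (+-comm a b)) (pow-+ c b a x)

  ·ₛ-+ : ∀ a b S → (a + b) ·ₛ S ≡ a ·ₛ b ·ₛ S
  ·ₛ-+ a b S = begin
    (a + b) ·ₛ S                        ≡⟨ cong (_·ₛ S) (+-comm a b) ⟩
    img (pow c (b + a)) S               ≡⟨ img-cong (pow c (b + a)) (pow c b ∘ₚ pow c a) (pow-+ c b a) S ⟩
    img (pow c b ∘ₚ pow c a) S          ≡⟨ img-∘ₚ (pow c b) (pow c a) S ⟩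
    a ·ₛ b ·ₛ S                         ∎
    where open ≡-Reasoning

  ·-comm : ∀ a b x → a · b · x ≡ b · a · x
  ·-comm a b x = trans (sym (·-+ a b x)) (trans (cong (_· x) (+-comm a b)) (·-+ b a x))

  ∈-·ₛ : ∀ t → x ∈ S → t · x ∈ t ·ₛ S
  ∈-·ₛ t = ∈-img (pow c t)

  Fixes : Fin n → ℕ → Set
  Fixes x t = t · x ≡ x

  Stab : Subset n → ℕ → Set
  Stab S t = t ·ₛ S ≡ S

  Fixes-+ : ∀ a b → Fixes x a → Fixes x b → Fixes x (a + b)
  Fixes-+ {x = x} a b a·x≡x b·x≡x = trans (·-+ a b x) (trans (cong (a ·_) b·x≡x) a·x≡x)

  Fixes-multiples : ∀ {s} → Fixes x s → ∀ q → Fixes x (q * s)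
  Fixes-multiples {x = x} = multiples {P = Fixes x} refl Fixes-+

  Stab-+ : ∀ a b → Stab S a → Stab S b → Stab S (a + b)
  Stab-+ {S = S} a b a·S≡S b·S≡S = trans (·ₛ-+ a b S) (trans (cong (a ·ₛ_) b·S≡S) a·S≡S)

  Stab-∸ : ∀ a b → Stab S (a + b) → Stab S a → Stab S b
  Stab-∸ {S = S} a b stab a·S≡S =
    trans (cong (b ·ₛ_) (sym a·S≡S)) (trans (sym (·ₛ-+ b a S)) (trans (cong (_·ₛ S) (+-comm b a)) stab))

  Stab-multiples : ∀ {s} → Stab S s → ∀ q → Stab S (q * s)
  Stab-multiples {S = S} = multiples {P = Stab S} (img-id S) Stab-+

  gap-fixes : ∀ {i j} → i < j → i · α ≡ j · α → Fixes α (j ∸ i)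
  gap-fixes {i} {j} i<j i·α≡j·α = semiregular (j ∸ i) {i · α} returns α
    where
    returns : (j ∸ i) · i · α ≡ i · α
    returns = trans (sym (·-+ (j ∸ i) i α)) (trans (cong (_· α) (m∸n+n≡m (<⇒≤ i<j))) (sym i·α≡j·α))

  -- The order of c, read off at α; by semiregularity it is the order on every point.
  opaque
    order : Period (Fixes α)
    order with i , j , i<j , i·α≡j·α ← Finₚ.pigeonhole (n<1+n n) (λ (i : Fin (suc n)) → toℕ i · α) =
      period-search (λ t → t · α Fin.≟ α) (m<n⇒0<n∸m i<j) (gap-fixes i<j i·α≡j·α)

  open Period order using () renaming (period to N; holds to N·α≡α; minimal to order-minimal)

  instance
    N-nonZero : NonZero N
    N-nonZero = Period.nonZero order

  N·ₛS≡S : ∀ S → N ·ₛ S ≡ S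
  N·ₛS≡S S = trans (img-cong (pow c N) id (semiregular N N·α≡α) S) (img-id S)

  N·x≡x : ∀ x → N · x ≡ x
  N·x≡x = semiregular N N·α≡α

  ·-inverseˡ : ∀ {u} → u ≤ N → ∀ x → (N ∸ u) · u · x ≡ x
  ·-inverseˡ {u} u≤N x = trans (sym (·-+ (N ∸ u) u x)) (trans (cong (_· x) (m∸n+n≡m u≤N)) (N·x≡x x))

  ·-inverseʳ : ∀ {u} → u ≤ N → ∀ x → u · (N ∸ u) · x ≡ x
  ·-inverseʳ {u} u≤N x = trans (sym (·-+ u (N ∸ u) x)) (trans (cong (_· x) (m+[n∸m]≡n u≤N)) (N·x≡x x))

  ·ₛ-inverseˡ : ∀ {u} → u ≤ N → ∀ S → (N ∸ u) ·ₛ u ·ₛ S ≡ S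
  ·ₛ-inverseˡ {u} u≤N S = trans (sym (·ₛ-+ (N ∸ u) u S)) (trans (cong (_·ₛ S) (m∸n+n≡m u≤N)) (N·ₛS≡S S))

  ·ₛ-inverseʳ : ∀ {u} → u ≤ N → ∀ S → u ·ₛ (N ∸ u) ·ₛ S ≡ S
  ·ₛ-inverseʳ {u} u≤N S = trans (sym (·ₛ-+ u (N ∸ u) S)) (trans (cong (_·ₛ S) (m+[n∸m]≡n u≤N)) (N·ₛS≡S S))

  ·α-mod : ∀ t → t · α ≡ (t % N) · α
  ·α-mod t = begin
    t · α                       ≡⟨ cong (_· α) (m≡m%n+[m/n]*n t N) ⟩
    (t % N + t / N * N) · α     ≡⟨ ·-+ (t % N) (t / N * N) α ⟩
    t % N · t / N * N · α       ≡⟨ cong (t % N ·_) (Fixes-multiples N·α≡α (t / N)) ⟩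
    t % N · α                   ∎
    where open ≡-Reasoning

  position : ∀ x → ∃ λ t → t < N × t · α ≡ x
  position x with t , t·α≡x ← transitive x = t % N , m%n<n t N , trans (sym (·α-mod t)) t·α≡x

  exponent : Fin n → ℕ
  exponent x = proj₁ (position x)

  exponent≤N : ∀ x → exponent x ≤ N
  exponent≤N x = <⇒≤ (proj₁ (proj₂ (position x)))

  exponent-position : ∀ x → exponent x · α ≡ x
  exponent-position x = proj₂ (proj₂ (position x))

  Stab-difference : ∀ {u v} → v ≤ N → u ·ₛ S ≡ v ·ₛ S → Stab S ((N ∸ v) + u)
  Stab-difference {S = S} {u} {v} v≤N u·S≡v·S =
    trans (·ₛ-+ (N ∸ v) u S) (trans (cong ((N ∸ v) ·ₛ_) u·S≡v·S) (·ₛ-inverseˡ v≤N S))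

  Fixes-difference : ∀ {u v} → v ≤ N → Fixes α ((N ∸ v) + u) → u · α ≡ v · α
  Fixes-difference {u} {v} v≤N fixes =
    trans (sym (·-inverseʳ v≤N (u · α))) (cong (v ·_) (trans (sym (·-+ (N ∸ v) u α)) fixes))

  ·α-distinct : ∀ {i j} → i < j → j < N → i · α ≢ j · α
  ·α-distinct {i} {j} i<j j<N i·α≡j·α =
    order-minimal (m<n⇒0<n∸m i<j) (≤-<-trans (m∸n≤m j i) j<N) (gap-fixes i<j i·α≡j·α)

  ·α-injective : ∀ {i j} → i < N → j < N → i · α ≡ j · α → i ≡ j
  ·α-injective {i} {j} i<N j<N i·α≡j·α with <-cmp i j
  ... | tri< i<j _ _ = ⊥-elim (·α-distinct i<j j<N i·α≡j·α)
  ... | tri≈ _ i≡j _ = i≡j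
  ... | tri> _ _ j<i = ⊥-elim (·α-distinct j<i i<N (sym i·α≡j·α))

  N≤n : N ≤ n
  N≤n = Finₚ.injective⇒≤ {f = λ (i : Fin N) → toℕ i · α}
    λ eq → Finₚ.toℕ-injective (·α-injective (Finₚ.toℕ<n _) (Finₚ.toℕ<n _) eq)

  NontriviallyStabilised : Subset n → Set
  NontriviallyStabilised S = ∃ λ b → Stab S b × b · α ≢ α

  module FixedLine {j : Fin m} (α∈L : α ∈ line X j) {b} (Stab-b : Stab (line X j) b) (b·α≢α : b · α ≢ α) where

    L : Subset n
    L = line X j

    opaque
      rotation : Period (Stab L)
      rotation = period-search {P = Stab L} (λ t → ≡-dec _≟ᵇ_ (t ·ₛ L) L) {b}
        (n≢0⇒n>0 λ { refl → b·α≢α refl }) Stab-b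

    open Period rotation public using () renaming (period to s; holds to Stab-s)

    instance
      s-nonZero : NonZero s
      s-nonZero = Period.nonZero rotation

    s∣ : ∀ t → Stab L t → s ∣ t
    s∣ t = period-∣ {P = Stab L} (img-id L) Stab-+ Stab-∸ rotation {t}

    s·α≢α : s · α ≢ α
    s·α≢α s·α≡α with divides q b≡q*s ← s∣ b Stab-b =
      b·α≢α (subst (λ t → t · α ≡ α) (sym b≡q*s) (Fixes-multiples s·α≡α q))

    s<N : s < N
    s<N = ≤∧≢⇒< (∣⇒≤ (s∣ N (N·ₛS≡S L)))
      λ s≡N → s·α≢α (subst (λ t → t · α ≡ α) (sym s≡N) N·α≡α)

    s·∈L : x ∈ L → s · x ∈ L
    s·∈L {x} x∈L = subst (s · x ∈_) Stab-s (∈-·ₛ s x∈L)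

    -- The translate of L through t · α also passes through s · t · α, and so does L.
    Stab-position : ∀ t → t · α ∈ L → Stab L t
    Stab-position t t·α∈L with j′ , t·L≡L′ ← translate t j = trans t·L≡L′ (cong (line X) (sym j≡j′))
      where
      j≡j′ : j ≡ j′
      j≡j′ = lines-through-two-points X (λ eq → s·α≢α (semiregular s (sym eq) α))
        t·α∈L (s·∈L t·α∈L)
        (subst (t · α ∈_) t·L≡L′ (∈-·ₛ t α∈L))
        (subst (_∈ line X j′) (·-comm t s α) (subst (t · s · α ∈_) t·L≡L′ (∈-·ₛ t (s·∈L α∈L))))

    ·ₛ-mod : ∀ t → t ·ₛ L ≡ (t % s) ·ₛ L
    ·ₛ-mod t = begin
      t ·ₛ L                     ≡⟨ cong (_·ₛ L) (m≡m%n+[m/n]*n t s) ⟩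
      (t % s + t / s * s) ·ₛ L   ≡⟨ ·ₛ-+ (t % s) (t / s * s) L ⟩
      t % s ·ₛ t / s * s ·ₛ L    ≡⟨ cong (t % s ·ₛ_) (Stab-multiples Stab-s (t / s)) ⟩
      t % s ·ₛ L                 ∎
      where open ≡-Reasoning

    o : ℕ
    o = _∣_.quotient (s∣ N (N·ₛS≡S L))

    N≡o*s : N ≡ o * s
    N≡o*s = _∣_.equality (s∣ N (N·ₛS≡S L))

    orbit : ℕ → Fin n
    orbit q = (q * s) · α

    L≡orbit : L ≡ imageUpTo orbit o
    L≡orbit = ⊆-antisym L⊆orbit orbit⊆L
      where
      L⊆orbit : L ⊆ imageUpTo orbit o
      L⊆orbit {x} x∈L with t , t<N , t·α≡x ← position x
        with divides q t≡q*s ← s∣ t (Stab-position t (subst (_∈ L) (sym t·α≡x) x∈L)) =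
        subst (_∈ imageUpTo orbit o) (trans (cong (_· α) (sym t≡q*s)) t·α≡x)
          (∈-imageUpTo orbit (*-cancelʳ-< s q o (subst₂ _<_ t≡q*s N≡o*s t<N)))
      orbit⊆L : imageUpTo orbit o ⊆ L
      orbit⊆L x∈orbit with q , _ , refl ← ∈-imageUpTo⁻ orbit o x∈orbit =
        subst (orbit q ∈_) (Stab-multiples Stab-s q) (∈-·ₛ (q * s) α∈L)

    N≡∣L∣*s : N ≡ ∣ L ∣ * s
    N≡∣L∣*s = trans N≡o*s (cong (_* s) (sym ∣L∣≡o))
      where
      q*s<N : ∀ {q} → q < o → q * s < N
      q*s<N {q} q<o = subst (q * s <_) (sym N≡o*s) (*-monoˡ-< s q<o)
      ∣L∣≡o : ∣ L ∣ ≡ o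
      ∣L∣≡o = trans (cong ∣_∣ L≡orbit) (∣imageUpTo∣ orbit o λ {q} {r} q<o r<o eq →
        *-cancelʳ-≡ q r s (·α-injective (q*s<N q<o) (q*s<N r<o) eq))

  fixed-lines-through-α-equal : ∀ {i j} → α ∈ line X i → α ∈ line X j →
    NontriviallyStabilised (line X i) → NontriviallyStabilised (line X j) →
    ∣ line X i ∣ ≡ ∣ line X j ∣ → i ≡ j
  fixed-lines-through-α-equal {i} {j} α∈i α∈j (a , Stab-a , a·α≢α) (b , Stab-b , b·α≢α) ∣i∣≡∣j∣ =
    lines-through-two-points X (λ α≡s·α → Li.s·α≢α (sym α≡s·α)) α∈i (Li.s·∈L α∈i) α∈j
      (subst (λ t → t · α ∈ line X j) (sym si≡sj) (Lj.s·∈L α∈j))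
    where
    module Li = FixedLine α∈i {a} Stab-a a·α≢α
    module Lj = FixedLine α∈j {b} Stab-b b·α≢α
    si≡sj : Li.s ≡ Lj.s
    si≡sj = *-cancelˡ-≡ Li.s Lj.s ∣ line X i ∣ ⦃ >-nonZero (x∈p⇒0<∣p∣ α∈i) ⦄
      (trans (sym Li.N≡∣L∣*s) (trans Lj.N≡∣L∣*s (cong (_* Lj.s) (sym ∣i∣≡∣j∣))))

  module _ (k : ℕ) (uniform : ∀ j → ∣ line X j ∣ ≡ k) (balanced : n ≡ m)
           {β : Fin m} (α∈β : α ∈ line X β) {b : ℕ} (Stab-b : Stab (line X β) b) (b·α≢α : b · α ≢ α) where

    private
      module Lβ = FixedLine α∈β {b} Stab-b b·α≢α

    candidates : Fin m → Fin (suc n) → Fin m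
    candidates γ′ Fin.zero    = β
    candidates γ′ (Fin.suc y) = proj₁ (translate (exponent y) γ′)

    translate-through-α : ∀ γ → ∃ λ t → ∃ λ γ′ → α ∈ line X γ′ × t ·ₛ line X γ′ ≡ line X γ
    translate-through-α γ with nonempty? (line X γ)
    ... | no γ-empty = ⊥-elim (<⇒≢ (x∈p⇒0<∣p∣ α∈β)
          (trans (sym (∣⊥∣≡0 n)) (trans (cong ∣_∣ (sym (Empty-unique γ-empty))) (trans (uniform γ) (sym (uniform β))))))
    ... | yes (x , x∈γ) with t , t<N , t·α≡x ← position x with γ′ , N∸t·γ≡γ′ ← translate (N ∸ t) γ =
      t , γ′ , subst (_∈ line X γ′) α≡ (subst ((N ∸ t) · x ∈_) N∸t·γ≡γ′ (∈-·ₛ (N ∸ t) x∈γ)) ,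
      trans (cong (t ·ₛ_) (sym N∸t·γ≡γ′)) (·ₛ-inverseʳ (<⇒≤ t<N) (line X γ))
      where
      α≡ : (N ∸ t) · x ≡ α
      α≡ = trans (cong ((N ∸ t) ·_) (sym t·α≡x)) (·-inverseˡ (<⇒≤ t<N) α)

    -- Pigeonhole on β and the N translates of γ′: either β is among them, or two of them coincide
    -- and then γ′ is a second line through α with a nontrivial stabiliser, hence γ′ = β.
    every-line-translate-of-β : ∀ γ → ∃ λ t → t ·ₛ line X β ≡ line X γ
    every-line-translate-of-β γ with t , γ′ , α∈γ′ , t·γ′≡γ ← translate-through-α γ
      with Finₚ.pigeonhole (subst (_< suc n) balanced (n<1+n n)) (candidates γ′)
    ... | Fin.zero , Fin.suc y , _ , β≡γ′y = t + (N ∸ u) , (begin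
      (t + (N ∸ u)) ·ₛ line X β           ≡⟨ ·ₛ-+ t (N ∸ u) (line X β) ⟩
      t ·ₛ (N ∸ u) ·ₛ line X β            ≡⟨ cong (λ L → t ·ₛ (N ∸ u) ·ₛ L) β≡u·γ′ ⟩
      t ·ₛ (N ∸ u) ·ₛ u ·ₛ line X γ′      ≡⟨ cong (t ·ₛ_) (·ₛ-inverseˡ (exponent≤N y) (line X γ′)) ⟩
      t ·ₛ line X γ′                       ≡⟨ t·γ′≡γ ⟩
      line X γ                             ∎)
      where
      open ≡-Reasoning
      u = exponent y
      β≡u·γ′ : line X β ≡ u ·ₛ line X γ′
      β≡u·γ′ = trans (cong (line X) β≡γ′y) (sym (proj₂ (translate u γ′)))
    ... | Fin.suc x , Fin.suc y , x<y , γ′x≡γ′y = t , subst (λ δ → t ·ₛ line X δ ≡ line X γ) γ′≡β t·γ′≡γ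
      where
      u = exponent x
      v = exponent y
      γ′≡β : γ′ ≡ β
      γ′≡β = fixed-lines-through-α-equal α∈γ′ α∈β
        ( (N ∸ v) + u
        , Stab-difference (exponent≤N y)
            (trans (proj₂ (translate u γ′)) (trans (cong (line X) γ′x≡γ′y) (sym (proj₂ (translate v γ′)))))
        , λ fixes → Finₚ.<⇒≢ (s≤s⁻¹ x<y)
            (trans (sym (exponent-position x)) (trans (Fixes-difference (exponent≤N y) fixes) (exponent-position y))))
        (b , Stab-b , b·α≢α) (trans (uniform γ′) (sym (uniform β)))

    -- All lines are translates of β, and β has only s < m distinct translates.
    no-line-through-α-nontrivially-stabilised : ⊥
    no-line-through-α-nontrivially-stabilised = Finₚ.<⇒notInjective s<m residue-injective
      where
      s<m : Lβ.s < m
      s<m = subst (Lβ.s <_) balanced (<-≤-trans Lβ.s<N N≤n)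
      exponent-of : Fin m → ℕ
      exponent-of γ = proj₁ (every-line-translate-of-β γ)
      residue : Fin m → Fin Lβ.s
      residue γ = Fin.fromℕ< (m%n<n (exponent-of γ) Lβ.s)
      residue-injective : Injective _≡_ _≡_ residue
      residue-injective {γ} {δ} same-residue = line-inj X γ δ (begin
        line X γ                              ≡⟨ sym (proj₂ (every-line-translate-of-β γ)) ⟩
        exponent-of γ ·ₛ line X β             ≡⟨ Lβ.·ₛ-mod (exponent-of γ) ⟩
        (exponent-of γ % Lβ.s) ·ₛ line X β    ≡⟨ cong (_·ₛ line X β) %-equal ⟩
        (exponent-of δ % Lβ.s) ·ₛ line X β    ≡⟨ sym (Lβ.·ₛ-mod (exponent-of δ)) ⟩
        exponent-of δ ·ₛ line X β             ≡⟨ proj₂ (every-line-translate-of-β δ) ⟩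
        line X δ                              ∎)
        where
        open ≡-Reasoning
        %-equal : exponent-of γ % Lβ.s ≡ exponent-of δ % Lβ.s
        %-equal = trans (sym (Finₚ.toℕ-fromℕ< _)) (trans (cong toℕ same-residue) (Finₚ.toℕ-fromℕ< _))

module _ {n : ℕ} {F K : Perm n → Set} (F-inv : ∀ {f} → F f → F (flip f)) {f : Perm n} (f∈F : F f)
         {α : Fin n} {B : Subset n} (α∈B : α ∈ B) where

  line-orbit-inclusion⇒f±¹α∈B : LineOrbitSub F (λ g → K g × g ⟨$⟩ʳ α ≡ α) B →
    f ⟨$⟩ˡ α ∈ B × f ⟨$⟩ʳ α ∈ B
  line-orbit-inclusion⇒f±¹α∈B sub = through f f∈F , through (flip f) (F-inv f∈F)
    where
    through : ∀ h → F h → h ⟨$⟩ˡ α ∈ B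
    through h h∈F with g , (_ , g·α≡α) , g·B≡h·B ← sub (img h B) (h , h∈F , refl) =
      ∈-img⁻ {g = h} (subst₂ _∈_ g·α≡α g·B≡h·B (∈-img g α∈B))

  point-orbit-inclusion⇒f±¹α∈B : PtOrbitSub F (λ g → K g × img g B ≡ B) α →
    f ⟨$⟩ˡ α ∈ B × f ⟨$⟩ʳ α ∈ B
  point-orbit-inclusion⇒f±¹α∈B sub = through (flip f) (F-inv f∈F) , through f f∈F
    where
    through : ∀ h → F h → h ⟨$⟩ʳ α ∈ B
    through h h∈F with g , (_ , g·B≡B) , g·α≡h·α ← sub (h ⟨$⟩ʳ α) (h , h∈F , refl) =
      subst₂ _∈_ g·α≡h·α g·B≡B (∈-img g α∈B)

automorphism-fixes-line : (X : Geometry n m) {f : Perm n} → IsAut X f → ∀ {α β} → f ⟨$⟩ʳ α ≢ α →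
  α ∈ line X β → f ⟨$⟩ˡ α ∈ line X β → f ⟨$⟩ʳ α ∈ line X β → img f (line X β) ≡ line X β
automorphism-fixes-line X {f} (f-maps , _) {α} {β} f·α≢α α∈β f⁻¹α∈β fα∈β
  with β′ , f·β≡β′ ← f-maps β = trans f·β≡β′ (cong (line X) (sym β≡β′))
  where
  β≡β′ : β ≡ β′
  β≡β′ = lines-through-two-points X (f·α≢α ∘′ sym) α∈β fα∈β
    (subst₂ _∈_ (inverseʳ f) f·β≡β′ (∈-img f f⁻¹α∈β)) (subst (_ ∈_) f·β≡β′ (∈-img f α∈β))

lemma2p3 : {n m : ℕ} (X : Geometry n m) →
    IsConfiguration X → IsBalanced X → IsConnected X →
    (C : Subgroup n) → IsRegularCyclic C → InAut X C →
    (G : Subgroup n) → IsPrecMinimal G → C ⊆G G → InAut X G →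
    (α : Fin n) (β : Fin m) → α ∈ line X β →
    (F : Subgroup n) → F ⊆G C → Nontrivial F →
    ¬ LineOrbitSub (mem F) (PtStab G α) (line X β) ×
    ¬ PtOrbitSub (mem F) (LineStab G (line X β)) α
lemma2p3 X (_ , k , _ , _ , uniform) balanced _ C ((c , C≡⟨c⟩) , transitiveC , semiregularC) C≤AutX
         G _ _ _ α β α∈β F F≤C (f , f∈F , f≉id) =
  (λ sub → f-fixes-no-line (line-orbit-inclusion⇒f±¹α∈B (inv F) f∈F α∈β sub)) ,
  (λ sub → f-fixes-no-line (point-orbit-inclusion⇒f±¹α∈B (inv F) f∈F α∈β sub))
  where
  f∈C = F≤C f f∈F
  cᵗ∈C : ∀ t → mem C (pow c t)
  cᵗ∈C t = Equivalence.from (C≡⟨c⟩ (pow c t)) (t , λ _ → refl)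
  cᵗ-reaches : ∀ x → ∃ λ t → pow c t ⟨$⟩ʳ α ≡ x
  cᵗ-reaches x with g , g∈C , g·α≡x ← transitiveC α x with t , g≈cᵗ ← Equivalence.to (C≡⟨c⟩ g) g∈C =
    t , trans (sym (g≈cᵗ α)) g·α≡x
  open RegularCyclicAction X c α (λ t → semiregularC _ (pow c t) (cᵗ∈C t)) cᵗ-reaches
    (λ t → proj₁ (C≤AutX (pow c t) (cᵗ∈C t)))
  f-fixes-no-line : f ⟨$⟩ˡ α ∈ line X β × f ⟨$⟩ʳ α ∈ line X β → ⊥
  f-fixes-no-line (f⁻¹α∈β , fα∈β) with b , f≈cᵇ ← Equivalence.to (C≡⟨c⟩ f) f∈C =
    no-line-through-α-nontrivially-stabilised k uniform balanced α∈β {b}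
      (trans (img-cong (pow c b) f (λ x → sym (f≈cᵇ x)) (line X β))
             (automorphism-fixes-line X {f} (C≤AutX f f∈C) f·α≢α α∈β f⁻¹α∈β fα∈β))
      (f·α≢α ∘′ trans (f≈cᵇ α))
    where
    f·α≢α : f ⟨$⟩ʳ α ≢ α
    f·α≢α = f≉id ∘′ semiregularC α f f∈C
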